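{- Let $\langle\chi,\vec a\rangle$ be a loop and $\check\phi$ a quantifier-free formula over $\vec x$, where $\chi(\vec x)\equiv\bigwedge_{i=1}^k C_i$ in CNF and each clause $C_i$ contains an inequation $e_i(\vec x)>0$ (as one of its disjuncts) such that \[ \check\phi(\vec x)\land e_i(\vec x)\ge e_i(\vec a(\vec x))\implies e_i(\vec a(\vec x))\ge e_i(\vec a^2(\vec x)) \] is valid. Then the conditional acceleration technique mapping $(\langle\chi,\vec a\rangle,\check\phi)$ to \[ \vec x'=\vec a^n(\vec x)\land\bigwedge_{i=1}^k\bigl(e_i(\vec x)>0\land e_i(\vec a^{n-1}(\vec x))>0\bigr) \] is sound. If moreover $C_i\equiv e_i>0$ for all $i\in[1,k]$, then it is exact.
   Context: Fix $d\ge 1$, integer variables $\vec x=(x_1,\dots,x_d)$, $\vec x'$, and $n$ ranging over $\mathbb N$; $\vec y=(\vec x,n,\vec x')$. A loop $\langle\chi,\vec a\rangle$ consists of a quantifier-free formula $\chi$ over atoms $p>0$ ($p$ an arithmetic expression over $\vec x$, integer semantics) and a map $\vec a:\mathbb Z^d\to\mathbb Z^d$ given by expressions over $\vec x$; $\vec a^m$ is $m$-fold application. $\vec x\longrightarrow_{\langle\chi,\vec a\rangle}\vec x'$ iff $\chi(\vec x)\land\vec x'=\vec a(\vec x)$, and $\longrightarrow^m$ is its $m$-fold composition. For a pair $(\langle\chi,\vec a\rangle,\check\phi)$ and a formula $\psi$ over $\vec y$ assigned to it, soundness means: for all $\vec x,\vec x'\in\mathbb Z^d$ and all $n>0$, $\vec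 x\longrightarrow^n_{\langle\check\phi,\vec a\rangle}\vec x'\land\psi$ implies $\vec x\longrightarrow^n_{\langle\chi,\vec a\rangle}\vec x'$; exactness means soundness plus: $\vec x\longrightarrow^n_{\langle\chi\land\check\phi,\vec a\rangle}\vec x'$ implies $\psi$. Validity means truth for all integer values of the free variables. -}

module Defs where

open import Data.Nat using (ℕ; zero; suc; _<_; _∸_)
open import Data.Integer using (ℤ; 0ℤ; _+_; _*_; -_; _>_; _≥_)
open import Data.Fin using (Fin)
open import Data.Vec using (Vec; lookup; map)
open import Data.List using (List)
open import Data.Product using (_×_)
open import Data.Sum using (_⊎_)
open import Data.Empty using (⊥)
open import Data.Unit using (⊤)
open import Relation.Nullary using (¬_)
open import Relation.Binary.PropositionalEquality using (_≡_)

data Expr (d : ℕ) : Set where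
  const : ℤ → Expr d
  var   : Fin d → Expr d
  add   : Expr d → Expr d → Expr d
  mul   : Expr d → Expr d → Expr d
  neg   : Expr d → Expr d

State : ℕ → Set
State d = Vec ℤ d

eval : ∀ {d} → Expr d → State d → ℤ
eval (const c) x = c
eval (var i)   x = lookup x i
eval (add p q) x = eval p x + eval q x
eval (mul p q) x = eval p x * eval q x
eval (neg p)   x = - eval p x

data Formula (d : ℕ) : Set where
  gt0  : Expr d → Formula d
  true false : Formula d
  and  : Formula d → Formula d → Formula d
  or   : Formula d → Formula d → Formula d
  not  : Formula d → Formula d

Sat : ∀ {d} → Formula d → State d → Set
Sat (gt0 p)   x = eval p x > 0ℤ
Sat true      x = ⊤
Sat false     x = ⊥
Sat (and φ ψ) x = Sat φ x × Sat ψ x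
Sat (or φ ψ)  x = Sat φ x ⊎ Sat ψ x
Sat (not φ)   x = ¬ Sat φ x

disj : ∀ {d} → List (Formula d) → Formula d
disj List.[] = false
disj (φ List.∷ φs) = or φ (disj φs)

cnf : ∀ {d} (k : ℕ) → (Fin k → List (Formula d)) → Formula d
cnf zero    C = true
cnf (suc k) C = and (disj (C Fin.zero)) (cnf k (λ i → C (Fin.suc i)))

Update : ℕ → Set
Update d = Vec (Expr d) d

apply : ∀ {d} → Update d → State d → State d
apply a x = map (λ e → eval e x) a

applyN : ∀ {d} → Update d → ℕ → State d → State d
applyN a zero    x = x
applyN a (suc m) x = apply a (applyN a m x)

Step : ∀ {d} → Formula d → Update d → State d → State d → Set
Step φ a x x' = Sat φ x × x' ≡ apply a x

data Steps {d} (φ : Formula d) (a : Update d) : ℕ → State d → State d → Set where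
  done : ∀ {x} → Steps φ a zero x x
  step : ∀ {m x y x'} → Step φ a x y → Steps φ a m y x' → Steps φ a (suc m) x x'

-- Formulas ψ over y = (x, n, x'), given semantically.
YPred : ℕ → Set₁
YPred d = State d → ℕ → State d → Set

Sound : ∀ {d} → Formula d → Update d → Formula d → YPred d → Set
Sound {d} χ a φ ψ = ∀ (x x' : State d) (n : ℕ) → 0 < n →
  Steps φ a n x x' → ψ x n x' → Steps χ a n x x'

Exact : ∀ {d} → Formula d → Update d → Formula d → YPred d → Set
Exact {d} χ a φ ψ = Sound χ a φ ψ ×
  (∀ (x x' : State d) (n : ℕ) → 0 < n →
     Steps (and χ φ) a n x x' → ψ x n x')

accelψ : ∀ {d} (a : Update d) (k : ℕ) (e : Fin k → Expr d) → YPred d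
accelψ a k e x n x' = x' ≡ applyN a n x ×
  (∀ (i : Fin k) → (eval (e i) x > 0ℤ) × (eval (e i) (applyN a (n ∸ 1) x) > 0ℤ))

-- Along a run of ⟨φ̌, a⟩ the hypothesis makes each sequence m ↦ e_i(a^m(x)) keep
-- descending once it has descended, so on [0, n-1] it is bounded below by one of its
-- endpoints.  Positivity of e_i at x and at a^{n-1}(x) therefore gives positivity along
-- the whole run, hence every clause C_i, i.e. a run of ⟨χ, a⟩.  Exactness is the
-- converse: when C_i is the atom e_i > 0, a run of ⟨χ ∧ φ̌, a⟩ has e_i > 0 at its first
-- and last guarded state.
module Submission where

open import Defs
open import Data.Nat using (ℕ; zero; suc; _≤_; _<_; _+_; _≤‴_; ≤‴-refl; ≤‴-step; s≤s; z≤n)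
open import Data.Nat.Properties using (≤‴⇒≤; ≤⇒≤‴; ≤-pred; ≤-refl; <⇒≤)
open import Data.Integer using (ℤ; 0ℤ; _≥_; _>_)
import Data.Integer.Properties as ℤ
open import Data.Fin using (Fin)
open import Data.List using (List; _∷_; [])
open import Data.List.Membership.Propositional using (_∈_)
open import Data.List.Relation.Unary.Any using (here; there)
open import Data.Product using (_×_; _,_; proj₁; proj₂)
open import Data.Sum using (_⊎_; inj₁; inj₂)
open import Relation.Binary.PropositionalEquality using (_≡_; refl; sym; trans; cong; subst)

DescentPersists : (ℕ → ℤ) → ℕ → Set
DescentPersists f N = ∀ j → 2 + j ≤ N → f j ≥ f (1 + j) → f (1 + j) ≥ f (2 + j)

module _ {f : ℕ → ℤ} {N : ℕ} (persists : DescentPersists f N) where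

  descent-persists-to-end : ∀ {j} → suc j ≤‴ N → f j ≥ f (suc j) → f (suc j) ≥ f N
  descent-persists-to-end ≤‴-refl        _    = ℤ.≤-refl
  descent-persists-to-end (≤‴-step 2+j≤N) desc =
    ℤ.≤-trans (descent-persists-to-end 2+j≤N next) next
    where next = persists _ (≤‴⇒≤ 2+j≤N) desc

  ≥-an-endpoint : ∀ m → m ≤ N → f m ≥ f 0 ⊎ f m ≥ f N
  ≥-an-endpoint zero    _      = inj₁ ℤ.≤-refl
  ≥-an-endpoint (suc m) 1+m≤N with ℤ.≤-total (f (suc m)) (f m)
  ... | inj₁ desc = inj₂ (descent-persists-to-end (≤⇒≤‴ 1+m≤N) desc)
  ... | inj₂ asc  with ≥-an-endpoint m (<⇒≤ 1+m≤N)
  ...   | inj₁ ≥f₀ = inj₁ (ℤ.≤-trans ≥f₀ asc)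
  ...   | inj₂ ≥fN = inj₂ (ℤ.≤-trans ≥fN asc)

  >-between-endpoints : ∀ {c} → f 0 > c → f N > c → ∀ m → m ≤ N → f m > c
  >-between-endpoints f₀>c fN>c m m≤N with ≥-an-endpoint m m≤N
  ... | inj₁ ≥f₀ = ℤ.<-≤-trans f₀>c ≥f₀
  ... | inj₂ ≥fN = ℤ.<-≤-trans fN>c ≥fN

module _ {d : ℕ} (a : Update d) where

  applyN-apply : ∀ m x → applyN a m (apply a x) ≡ apply a (applyN a m x)
  applyN-apply zero    x = refl
  applyN-apply (suc m) x = cong (apply a) (applyN-apply m x)

  Guarded : Formula d → ℕ → State d → Set
  Guarded χ n x = ∀ m → m < n → Sat χ (applyN a m x)

  Steps⇒Guarded : ∀ {χ n x x'} → Steps χ a n x x' → Guarded χ n x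
  Steps⇒Guarded (step (sat , _) rest) zero    _         = sat
  Steps⇒Guarded {χ} {x = x} (step (_ , refl) rest) (suc m) (s≤s m<n) =
    subst (Sat χ) (applyN-apply m x) (Steps⇒Guarded rest m m<n)

  Steps⇒≡applyN : ∀ {χ n x x'} → Steps χ a n x x' → x' ≡ applyN a n x
  Steps⇒≡applyN done = refl
  Steps⇒≡applyN {n = suc n} {x} (step (_ , refl) rest) =
    trans (Steps⇒≡applyN rest) (applyN-apply n x)

  Guarded⇒Steps : ∀ {χ} n x → Guarded χ n x → Steps χ a n x (applyN a n x)
  Guarded⇒Steps zero    x _       = done
  Guarded⇒Steps {χ} (suc n) x guarded =
    step (guarded zero (s≤s z≤n) , refl)
      (subst (Steps χ a n (apply a x)) (applyN-apply n x)
        (Guarded⇒Steps n (apply a x) guarded-after-step))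
    where
    guarded-after-step : Guarded χ n (apply a x)
    guarded-after-step m m<n =
      subst (Sat χ) (sym (applyN-apply m x)) (guarded (suc m) (s≤s m<n))

  Guarded⇒DescentPersists : ∀ {φ} (e : Expr d) →
    (∀ y → Sat φ y → eval e y ≥ eval e (apply a y) →
       eval e (apply a y) ≥ eval e (apply a (apply a y))) →
    ∀ {N x} → Guarded φ (suc N) x → DescentPersists (λ m → eval e (applyN a m x)) N
  Guarded⇒DescentPersists e mono guarded j 2+j≤N =
    mono _ (guarded j (s≤s (<⇒≤ (<⇒≤ 2+j≤N))))

Sat-disj : ∀ {d} {ψ : Formula d} {ψs y} → ψ ∈ ψs → Sat ψ y → Sat (disj ψs) y
Sat-disj (here refl) sat = inj₁ sat
Sat-disj (there ψ∈ψs) sat = inj₂ (Sat-disj ψ∈ψs sat)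

Sat-cnf⁺ : ∀ {d} k (C : Fin k → List (Formula d)) {y} →
  (∀ i → Sat (disj (C i)) y) → Sat (cnf k C) y
Sat-cnf⁺ zero    C sats = _
Sat-cnf⁺ (suc k) C sats =
  sats Fin.zero , Sat-cnf⁺ k (λ i → C (Fin.suc i)) (λ i → sats (Fin.suc i))

Sat-cnf⁻ : ∀ {d} k (C : Fin k → List (Formula d)) {y} →
  Sat (cnf k C) y → ∀ i → Sat (disj (C i)) y
Sat-cnf⁻ (suc k) C (sat , _)  Fin.zero    = sat
Sat-cnf⁻ (suc k) C (_ , sats) (Fin.suc i) = Sat-cnf⁻ k (λ j → C (Fin.suc j)) sats i

Sat-cnf-of-singletons⁻ : ∀ {d} k (C : Fin k → List (Formula d)) {ψ : Fin k → Formula d} {y} →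
  (∀ i → C i ≡ ψ i ∷ []) → Sat (cnf k C) y → ∀ i → Sat (ψ i) y
Sat-cnf-of-singletons⁻ k C {y = y} C≡[ψ] sat i
  with subst (λ ψs → Sat (disj ψs) y) (C≡[ψ] i) (Sat-cnf⁻ k C sat i)
... | inj₁ sat-ψᵢ = sat-ψᵢ

theorem11 : (d : ℕ) → 1 ≤ d → (a : Update d) → (φ : Formula d) →
    (k : ℕ) → (C : Fin k → List (Formula d)) → (e : Fin k → Expr d) →
    (∀ (i : Fin k) → gt0 (e i) ∈ C i) →
    (∀ (i : Fin k) (x : State d) → Sat φ x →
       eval (e i) x ≥ eval (e i) (apply a x) →
       eval (e i) (apply a x) ≥ eval (e i) (apply a (apply a x))) →
    Sound (cnf k C) a φ (accelψ a k e) ×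
    ((∀ (i : Fin k) → C i ≡ gt0 (e i) ∷ []) → Exact (cnf k C) a φ (accelψ a k e))
theorem11 d _ a φ k C e e∈C mono = sound , λ C≡e>0 → sound , complete C≡e>0
  where
  sound : Sound (cnf k C) a φ (accelψ a k e)
  sound x x' (suc N) _ run (x'≡ , ends) =
    subst (Steps (cnf k C) a (suc N) x) (sym x'≡) (Guarded⇒Steps a (suc N) x guarded)
    where
    e>0 : ∀ i m → m ≤ N → eval (e i) (applyN a m x) > 0ℤ
    e>0 i = >-between-endpoints
              (Guarded⇒DescentPersists a (e i) (mono i) (Steps⇒Guarded a run))
              (proj₁ (ends i)) (proj₂ (ends i))
    guarded : Guarded a (cnf k C) (suc N) x
    guarded m m<1+N = Sat-cnf⁺ k C (λ i → Sat-disj (e∈C i) (e>0 i m (≤-pred m<1+N)))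

  complete : (∀ i → C i ≡ gt0 (e i) ∷ []) →
    ∀ x x' n → 0 < n → Steps (and (cnf k C) φ) a n x x' → accelψ a k e x n x'
  complete C≡e>0 x x' (suc N) _ run =
    Steps⇒≡applyN a run , λ i → e>0 i (guarded 0 (s≤s z≤n)) , e>0 i (guarded N ≤-refl)
    where
    guarded : Guarded a (and (cnf k C) φ) (suc N) x
    guarded = Steps⇒Guarded a run
    e>0 : ∀ i {y} → Sat (and (cnf k C) φ) y → eval (e i) y > 0ℤ
    e>0 i (sat , _) = Sat-cnf-of-singletons⁻ k C C≡e>0 sat i
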